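{- Let $(\Sigma,P)$ be a g-hybrid knowledge base where $\Sigma$ is a $\mathcal{DLR}^{ -\leq}_{\mathcal{O}}$ knowledge base. Then $\Phi(\Sigma)\cup P$ is a guarded program whose size is polynomial in the size of $(\Sigma,P)$.
   Context: Programs: finite sets of rules $\alpha\leftarrow\beta$ where $\alpha,\beta$ are finite sets of literals (atoms $p(\vec t)$ or naf-literals $\mathit{not}\ p(\vec t)$), $\alpha$ contains at most one positive atom and it is not an equality atom. A free rule has the form $q(\vec X)\lor\mathit{not}\ q(\vec X)\leftarrow$. A rule $r:\alpha\leftarrow\beta$ is guarded if some positive body atom contains all variables of $r$; rules with a single variable $X$ count as guarded via the implicit body atom $X=X$. A guarded program is one whose non-free rules are all guarded. $\mathcal{DLR}^{ -\leq}_{\mathcal{O}}$: roles $\mathbf R ::= \top_n\mid\mathbf P\mid(\$i/n:C)\mid\neg\mathbf R\mid\mathbf R_1\sqcap\mathbf R_2\mid\{(o_1,\dots,o_n)\}$ and concepts $C ::= \top_1\mid A\mid\neg C\mid C_1\sqcap C_2\mid\exists[\$i]\mathbf R\mid\{o\}$ ($A$ concept names, $\mathbf P$ relation names of arity $2\le n\le n_{max}$, $o$ constants); role nominals are regarded as abbreviations of $(\$1/n:\{o_1\})\sqcap\dots\sqcap(\$n/n:\{o_n\})$. A knowledge base $\Sigma$ is a finite set of inclusion axioms $C_1\sqsubseteq C_2$ and $\mathbf R_1\sqsubseteq\mathbf R_2$ (same arity). A g-hybrid knowledge base is a pair $(\Sigma,P)$ with $\Sigma$ such a knowledge base and $P$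 a guarded program. Translation. $\mathrm{clos}(\Sigma)$ is the smallest set containing $\top_1$, both sides of every axiom, every concept/role subexpression of its members, and $\top_n$ whenever it contains an $n$-ary relation name; each member is used as a predicate symbol of matching arity. $\Phi(\Sigma)$ is the smallest program containing: $\leftarrow C(X),\mathit{not}\ D(X)$ for each $C\sqsubseteq D\in\Sigma$; $\leftarrow\mathbf R(\vec X),\mathit{not}\ \mathbf S(\vec X)$ for each role axiom $\mathbf R\sqsubseteq\mathbf S$; $\top_n(\vec X)\lor\mathit{not}\ \top_n(\vec X)\leftarrow$ for each $\top_n\in\mathrm{clos}(\Sigma)$; $\leftarrow\mathbf P(\vec X),\mathit{not}\ \top_n(\vec X)$ for each $n$-ary relation name $\mathbf P\in\mathrm{clos}(\Sigma)$; $\leftarrow\mathit{not}\ \top_1(X)$; and for each $D\in\mathrm{clos}(\Sigma)$: $D(o)\leftarrow$ if $D=\{o\}$; $D(\vec X)\lor\mathit{not}\ D(\vec X)\leftarrow$ if $D$ is a concept or relation name; $D(X)\leftarrow\mathit{not}\ E(X)$ if $D=\neg E$ for a concept $E$; $D(\vec X)\leftarrow\top_n(\vec X),\mathit{not}\ \mathbf R(\vec X)$ if $D=\neg\mathbf R$; $D(X)\leftarrow E(X),F(X)$ if $D=E\sqcap F$ (concepts); $D(\vec X)\leftarrow\mathbf E(\vec X),\mathbf F(\vec X)$ if $D=\mathbf E\sqcap\mathbf F$ (roles); $D(X_1,..,X_n)\leftarrow\top_n(X_1,..,X_n),C(X_i)$ if $D=(\$i/n:C)$; $D(X)\leftarrow\mathbf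 R(X_1,..,X_{i-1},X,X_{i+1},..,X_n)$ if $D=\exists[\$i]\mathbf R$. Here $\vec X=(X_1,\dots,X_n)$. -}

module Defs where

open import Data.Nat using (ℕ; zero; suc; _+_; _*_; _≤_; _^_)
open import Data.Fin using (Fin; toℕ)
open import Data.Vec using (Vec; []; _∷_)
open import Data.List using (List; []; _∷_; _++_; map; concatMap; upTo; length)
open import Data.Nat.ListAction using (sum)
open import Data.List.Relation.Unary.All using (All)
open import Data.List.Relation.Unary.Unique.Propositional using (Unique)
open import Data.List.Relation.Binary.Permutation.Propositional using (_↭_)
open import Data.List.Membership.Propositional using (_∈_)
open import Data.Product using (Σ; Σ-syntax; ∃; ∃-syntax; _×_; _,_)
open import Data.Sum using (_⊎_)
open import Relation.Binary.PropositionalEquality using (_≡_)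
open import Data.Unit using (⊤)
open import Data.Empty using (⊥)
import Data.Vec

Const : Set
Const = ℕ

ConceptName : Set
ConceptName = ℕ

RelName : Set          -- relation names P (the arity is the index of Role)
RelName = ℕ

-- DLR^{-≤}_O syntax.  Role n = n-ary roles; the position $i of an
-- n-ary role is an element of Fin n (i.e. $1..$n ↦ 0..n-1).

mutual
  data Concept : Set where
    top1   : Concept
    cname  : ConceptName → Concept
    cneg   : Concept → Concept
    cand   : Concept → Concept → Concept
    cexists : (n : ℕ) → Fin n → Role n → Concept
    cnom   : Const → Concept

  data Role : ℕ → Set where
    topN   : (n : ℕ) → Role n
    rname  : {n : ℕ} → RelName → Role n
    rsel   : {n : ℕ} → Fin n → Concept → Role n
    rneg   : {n : ℕ} → Role n → Role n
    rand   : {n : ℕ} → Role n → Role n → Role n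

-- Role nominals are abbreviations (they are not separate syntax):
-- {(o₁,…,oₙ)} := ($1/n:{o₁}) ⊓ … ⊓ ($n/n:{oₙ})
roleNom : {n : ℕ} → Vec Const (suc n) → Role (suc n)
roleNom os = Data.Vec.foldr₁ rand (Data.Vec.tabulate (λ i → rsel i (cnom (Data.Vec.lookup os i))))

mutual
  WFC : ℕ → Concept → Set
  WFC m top1 = ⊤
  WFC m (cname A) = ⊤
  WFC m (cneg C) = WFC m C
  WFC m (cand C D) = WFC m C × WFC m D
  WFC m (cexists n i R) = WFR m R
  WFC m (cnom o) = ⊤

  WFR : ℕ → {n : ℕ} → Role n → Set
  WFR m {n} (topN .n) = 2 ≤ n × n ≤ m
  WFR m {n} (rname P) = 2 ≤ n × n ≤ m
  WFR m {n} (rsel i C) = (2 ≤ n × n ≤ m) × WFC m C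
  WFR m {n} (rneg R) = (2 ≤ n × n ≤ m) × WFR m R
  WFR m {n} (rand R S) = (2 ≤ n × n ≤ m) × (WFR m R × WFR m S)

data Axiom : Set where
  cinc : Concept → Concept → Axiom
  rinc : (n : ℕ) → Role n → Role n → Axiom

KB : Set
KB = List Axiom

WFAx : ℕ → Axiom → Set
WFAx m (cinc C D) = WFC m C × WFC m D
WFAx m (rinc n R S) = WFR m R × WFR m S

IsDLRKB : ℕ → KB → Set
IsDLRKB m Sig = All (WFAx m) Sig

data Term : Set where
  var : ℕ → Term
  con : Const → Term

-- DL expressions (members of clos(Σ)), used as predicate symbols
data Expr : Set where
  ce : Concept → Expr
  re : (n : ℕ) → Role n → Expr

-- predicate symbols: DL expressions, or further program-only predicates
data Pred : Set where
  dl    : Expr → Pred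
  other : ℕ → Pred

data Atom : Set where
  app : Pred → List Term → Atom
  eqA : Term → Term → Atom

data Literal : Set where
  pos : Atom → Literal
  naf : Atom → Literal

record Rule : Set where
  constructor _⇐_
  field
    head : List Literal
    body : List Literal
open Rule public

Program : Set
Program = List Rule

termVars : Term → List ℕ
termVars (var x) = x ∷ []
termVars (con o) = []

atomVars : Atom → List ℕ
atomVars (app p ts) = concatMap termVars ts
atomVars (eqA s t) = termVars s ++ termVars t

litVars : Literal → List ℕ
litVars (pos a) = atomVars a
litVars (naf a) = atomVars a

ruleVars : Rule → List ℕ
ruleVars r = concatMap litVars (head r) ++ concatMap litVars (body r)

posAtoms : List Literal → List Atom
posAtoms [] = []
posAtoms (pos a ∷ ls) = a ∷ posAtoms ls
posAtoms (naf a ∷ ls) = posAtoms ls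

NotEq : Atom → Set
NotEq (app p ts) = ⊤
NotEq (eqA s t) = ⊥

WellFormedRule : Rule → Set
WellFormedRule r = length (posAtoms (head r)) ≤ 1 × All NotEq (posAtoms (head r))

Free : Rule → Set
Free r = body r ≡ [] ×
  (Σ[ q ∈ Pred ] Σ[ xs ∈ List ℕ ] Unique xs ×
     (head r ↭ (pos (app q (map var xs)) ∷ naf (app q (map var xs)) ∷ [])))

-- guarded: some positive body atom contains all variables of r; rules
-- with (at most) a single variable X are guarded via the implicit X = X
Guarded : Rule → Set
Guarded r =
  (Σ[ γ ∈ Atom ] (γ ∈ posAtoms (body r)) × All (λ x → x ∈ atomVars γ) (ruleVars r))
  ⊎ (Σ[ x ∈ ℕ ] All (λ y → y ≡ x) (ruleVars r))

GuardedProgram : Program → Set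
GuardedProgram P = All (λ r → WellFormedRule r × (Free r ⊎ Guarded r)) P

mutual
  sizeC : Concept → ℕ
  sizeC top1 = 1
  sizeC (cname A) = 1
  sizeC (cneg C) = suc (sizeC C)
  sizeC (cand C D) = suc (sizeC C + sizeC D)
  sizeC (cexists n i R) = suc (sizeR R)
  sizeC (cnom o) = 1

  sizeR : {n : ℕ} → Role n → ℕ
  sizeR (topN n) = 1
  sizeR (rname P) = 1
  sizeR (rsel i C) = suc (sizeC C)
  sizeR (rneg R) = suc (sizeR R)
  sizeR (rand R S) = suc (sizeR R + sizeR S)

sizeAx : Axiom → ℕ
sizeAx (cinc C D) = suc (sizeC C + sizeC D)
sizeAx (rinc n R S) = suc (sizeR R + sizeR S)

sizeKB : KB → ℕ
sizeKB Sig = sum (map sizeAx Sig)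

sizeAtom : Atom → ℕ
sizeAtom (app p ts) = suc (length ts)
sizeAtom (eqA s t) = 3

sizeLit : Literal → ℕ
sizeLit (pos a) = sizeAtom a
sizeLit (naf a) = suc (sizeAtom a)

sizeRule : Rule → ℕ
sizeRule r = suc (sum (map sizeLit (head r)) + sum (map sizeLit (body r)))

sizeProg : Program → ℕ
sizeProg P = sum (map sizeRule P)

mutual
  subC : Concept → List Expr
  subC top1 = ce top1 ∷ []
  subC (cname A) = ce (cname A) ∷ []
  subC (cneg C) = ce (cneg C) ∷ subC C
  subC (cand C D) = ce (cand C D) ∷ subC C ++ subC D
  subC (cexists n i R) = ce (cexists n i R) ∷ subR R
  subC (cnom o) = ce (cnom o) ∷ []

  subR : {n : ℕ} → Role n → List Expr
  subR {n} (topN .n) = re n (topN n) ∷ []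
  subR {n} (rname P) = re n (rname P) ∷ []
  subR {n} (rsel i C) = re n (rsel i C) ∷ subC C
  subR {n} (rneg R) = re n (rneg R) ∷ subR R
  subR {n} (rand R S) = re n (rand R S) ∷ subR R ++ subR S

subAx : Axiom → List Expr
subAx (cinc C D) = subC C ++ subC D
subAx (rinc n R S) = subR R ++ subR S

topsOf : Expr → List Expr
topsOf (re n (rname P)) = re n (topN n) ∷ []
topsOf _ = []

-- clos(Σ), listed (possibly with repetitions)
clos : KB → List Expr
clos Sig = ce top1 ∷ base ++ concatMap topsOf base
  where base = concatMap subAx Sig

X : Term
X = var 0

-- X⃗ = (X₁,…,Xₙ), encoded as variables 0 … n-1
Xs : ℕ → List Term
Xs n = map var (upTo n)

cA : Concept → Term → Atom
cA C t = app (dl (ce C)) (t ∷ [])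

rA : {n : ℕ} → Role n → List Term → Atom
rA {n} R ts = app (dl (re n R)) ts

axRules : Axiom → List Rule
axRules (cinc C D) = ([] ⇐ (pos (cA C X) ∷ naf (cA D X) ∷ [])) ∷ []
axRules (rinc n R S) = ([] ⇐ (pos (rA R (Xs n)) ∷ naf (rA S (Xs n)) ∷ [])) ∷ []

freeR : Atom → Rule
freeR a = (pos a ∷ naf a ∷ []) ⇐ []

exprRules : Expr → List Rule
exprRules (ce top1) = []
exprRules (ce (cname A)) = freeR (cA (cname A) X) ∷ []
exprRules (ce (cneg E)) = ((pos (cA (cneg E) X) ∷ []) ⇐ (naf (cA E X) ∷ [])) ∷ []
exprRules (ce (cand E F)) =
  ((pos (cA (cand E F) X) ∷ []) ⇐ (pos (cA E X) ∷ pos (cA F X) ∷ [])) ∷ []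
exprRules (ce (cexists n i R)) =
  -- D(X) ← R(X₁,…,X_{i-1},X,X_{i+1},…,Xₙ), with X := X_i
  ((pos (cA (cexists n i R) (var (toℕ i))) ∷ []) ⇐ (pos (rA R (Xs n)) ∷ [])) ∷ []
exprRules (ce (cnom o)) = ((pos (cA (cnom o) (con o)) ∷ []) ⇐ []) ∷ []
exprRules (re n (topN .n)) = freeR (rA (topN n) (Xs n)) ∷ []
exprRules (re n (rname P)) =
  freeR (rA (rname {n} P) (Xs n))
  ∷ ([] ⇐ (pos (rA (rname {n} P) (Xs n)) ∷ naf (rA (topN n) (Xs n)) ∷ []))
  ∷ []
exprRules (re n (rsel i C)) =
  ((pos (rA (rsel i C) (Xs n)) ∷ []) ⇐
     (pos (rA (topN n) (Xs n)) ∷ pos (cA C (var (toℕ i))) ∷ [])) ∷ []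
exprRules (re n (rneg R)) =
  ((pos (rA (rneg R) (Xs n)) ∷ []) ⇐
     (pos (rA (topN n) (Xs n)) ∷ naf (rA R (Xs n)) ∷ [])) ∷ []
exprRules (re n (rand R S)) =
  ((pos (rA (rand R S) (Xs n)) ∷ []) ⇐
     (pos (rA R (Xs n)) ∷ pos (rA S (Xs n)) ∷ [])) ∷ []

-- the free rule for ⊤₁ (⊤₁ ∈ clos(Σ) always) and  ← not ⊤₁(X)
Φ : KB → Program
Φ Sig = freeR (cA top1 X)
      ∷ ([] ⇐ (naf (cA top1 X) ∷ []))
      ∷ concatMap axRules Sig ++ concatMap exprRules (clos Sig)

-- Every rule of Φ(Σ) is free, mentions the single variable X, or has a
-- body atom R(X₁,…,Xₙ) containing all its variables.  Each rule has at
-- most three literals of arity at most max(1, n_max), and clos(Σ) has at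
-- most 2|Σ|+1 members, each contributing at most two rules; hence Φ(Σ) is
-- linear in |Σ| for fixed n_max.
module Submission where

open import Defs
open import Data.Bool using (T)
open import Data.Fin using (Fin; toℕ)
open import Data.Fin.Properties using (toℕ<n)
open import Data.List using (List; []; _∷_; _++_; map; concatMap; upTo; length)
open import Data.List.Membership.Propositional using (_∈_)
open import Data.List.Membership.Propositional.Properties using (∈-upTo⁺)
open import Data.List.Properties using (length-++; length-map; length-upTo; map-++)
open import Data.List.Relation.Binary.Permutation.Propositional using (↭-refl)
open import Data.List.Relation.Unary.All as All using (All; []; _∷_; universal)
open import Data.List.Relation.Unary.All.Properties using (++⁺; concat⁺; map⁺)
open import Data.List.Relation.Unary.Any using (here)
open import Data.List.Relation.Unary.Unique.Propositional using (Unique)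
open import Data.List.Relation.Unary.Unique.Propositional.Properties using (upTo⁺)
open import Data.Nat using (ℕ; suc; z≤n; s≤s; _+_; _*_; _^_; _≤_; _≤ᵇ_)
open import Data.Nat.ListAction using (sum)
open import Data.Nat.ListAction.Properties using (sum-++)
open import Data.Nat.Properties
open import Data.Nat.Tactic.RingSolver using (solve-∀)
open import Data.Product using (Σ-syntax; _×_; _,_; proj₁; proj₂)
open import Data.Sum using (_⊎_; inj₁; inj₂)
open import Data.Unit using (tt)
open import Function using (_∘_; id)
open import Relation.Binary.PropositionalEquality using (_≡_; refl; cong; subst; sym; trans)

private
  variable
    A B : Set
    b : ℕ

concatMap⁺ : {P : B → Set} (f : A → List B) {xs : List A} →
             All (All P ∘ f) xs → All P (concatMap f xs)
concatMap⁺ f = concat⁺ ∘ map⁺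

sum-map-mono : (f g : A → ℕ) {xs : List A} →
               All (λ x → f x ≤ g x) xs → sum (map f xs) ≤ sum (map g xs)
sum-map-mono f g []       = z≤n
sum-map-mono f g (p ∷ ps) = +-mono-≤ p (sum-map-mono f g ps)

sum-map-≤ : (f : A → ℕ) {xs : List A} →
            All (λ x → f x ≤ b) xs → sum (map f xs) ≤ length xs * b
sum-map-≤ f []       = z≤n
sum-map-≤ f (p ∷ ps) = +-mono-≤ p (sum-map-≤ f ps)

length-concatMap : (f : A → List B) (xs : List A) →
                   length (concatMap f xs) ≡ sum (map (length ∘ f) xs)
length-concatMap f []       = refl
length-concatMap f (x ∷ xs) =
  trans (length-++ (f x)) (cong (length (f x) +_) (length-concatMap f xs))

sizeProg-++ : (P Q : Program) → sizeProg (P ++ Q) ≡ sizeProg P + sizeProg Q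
sizeProg-++ P Q rewrite map-++ sizeRule P Q = sum-++ (map sizeRule P) (map sizeRule Q)

GuardedRule : Rule → Set
GuardedRule r = WellFormedRule r × (Free r ⊎ Guarded r)

VarsWithin : List ℕ → Literal → Set
VarsWithin vs l = All (_∈ vs) (litVars l)

⊆-self : (vs : List ℕ) → All (_∈ vs) vs
⊆-self vs = All.tabulate id

ruleVars-within : ∀ {vs} {hs bs : List Literal} →
                  All (VarsWithin vs) hs → All (VarsWithin vs) bs →
                  All (_∈ vs) (ruleVars (hs ⇐ bs))
ruleVars-within hs bs = ++⁺ (concatMap⁺ litVars hs) (concatMap⁺ litVars bs)

guardedBy : ∀ γ {hs bs} →
            All (VarsWithin (atomVars γ)) hs → All (VarsWithin (atomVars γ)) bs →
            Free (hs ⇐ (pos γ ∷ bs)) ⊎ Guarded (hs ⇐ (pos γ ∷ bs))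
guardedBy γ {bs = bs} hs-within bs-within = inj₂ (inj₁ (γ , here refl , all-within))
  where
  all-within = ruleVars-within {bs = pos γ ∷ bs} hs-within (⊆-self (atomVars γ) ∷ bs-within)

termVars-map-var : (xs : List ℕ) → concatMap termVars (map var xs) ≡ xs
termVars-map-var []       = refl
termVars-map-var (x ∷ xs) = cong (x ∷_) (termVars-map-var xs)

position-within : ∀ {n} (i : Fin n) → All (_∈ concatMap termVars (Xs n)) (toℕ i ∷ [])
position-within {n} i =
  subst (toℕ i ∈_) (sym (termVars-map-var (upTo n))) (∈-upTo⁺ (toℕ<n i)) ∷ []

freeR-guarded : ∀ {q xs} → Unique xs → GuardedRule (freeR (app q (map var xs)))
freeR-guarded {q} {xs} u = (s≤s z≤n , tt ∷ []) , inj₁ (refl , q , xs , u , ↭-refl)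

-- Pattern synonyms rather than functions: the rule they are about could
-- not be inferred from the expected type.
pattern wf-constraint   = z≤n , []
pattern wf-definite     = s≤s z≤n , tt ∷ []
pattern single-variable vs = inj₂ (inj₂ (0 , vs))

-- A literal over X⃗ has the variables of the guard R(X⃗) itself, so
-- ⊆-self _ bounds it, whatever its predicate.
exprRules-guarded : (e : Expr) → All GuardedRule (exprRules e)
exprRules-guarded (ce top1)            = []
exprRules-guarded (ce (cname A))       = freeR-guarded (upTo⁺ 1) ∷ []
exprRules-guarded (ce (cneg E))        = (wf-definite , single-variable (refl ∷ refl ∷ [])) ∷ []
exprRules-guarded (ce (cand E F))      = (wf-definite , single-variable (refl ∷ refl ∷ refl ∷ [])) ∷ []
exprRules-guarded (ce (cexists n i R)) =
  (wf-definite , guardedBy (rA R (Xs n)) (position-within i ∷ []) []) ∷ []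
exprRules-guarded (ce (cnom o))        = (wf-definite , single-variable []) ∷ []
exprRules-guarded (re n (topN .n))     = freeR-guarded (upTo⁺ n) ∷ []
exprRules-guarded (re n (rname P))     =
  freeR-guarded (upTo⁺ n) ∷
  (wf-constraint , guardedBy (rA (rname {n} P) (Xs n)) [] (⊆-self _ ∷ [])) ∷ []
exprRules-guarded (re n (rsel i C))    =
  (wf-definite , guardedBy (rA (topN n) (Xs n)) (⊆-self _ ∷ []) (position-within i ∷ [])) ∷ []
exprRules-guarded (re n (rneg R))      =
  (wf-definite , guardedBy (rA (topN n) (Xs n)) (⊆-self _ ∷ []) (⊆-self _ ∷ [])) ∷ []
exprRules-guarded (re n (rand R S))    =
  (wf-definite , guardedBy (rA R (Xs n)) (⊆-self _ ∷ []) (⊆-self _ ∷ [])) ∷ []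

axRules-guarded : (a : Axiom) → All GuardedRule (axRules a)
axRules-guarded (cinc C D)   = (wf-constraint , single-variable (refl ∷ refl ∷ [])) ∷ []
axRules-guarded (rinc n R S) =
  (wf-constraint , guardedBy (rA R (Xs n)) [] (⊆-self _ ∷ [])) ∷ []

Φ-guarded : (Sig : KB) → GuardedProgram (Φ Sig)
Φ-guarded Sig =
  freeR-guarded (upTo⁺ 1) ∷ (wf-constraint , single-variable (refl ∷ [])) ∷
  ++⁺ (concatMap⁺ axRules (universal axRules-guarded Sig))
      (concatMap⁺ exprRules (universal exprRules-guarded (clos Sig)))

WFE : ℕ → Expr → Set
WFE m (ce C)   = WFC m C
WFE m (re n R) = WFR m R

WFR⇒arity≤ : ∀ {m n} (R : Role n) → WFR m R → n ≤ m
WFR⇒arity≤ (topN _)   w = proj₂ w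
WFR⇒arity≤ (rname P)  w = proj₂ w
WFR⇒arity≤ (rsel i C) w = proj₂ (proj₁ w)
WFR⇒arity≤ (rneg R)   w = proj₂ (proj₁ w)
WFR⇒arity≤ (rand R S) w = proj₂ (proj₁ w)

mutual
  subC-wf : ∀ {m} (C : Concept) → WFC m C → All (WFE m) (subC C)
  subC-wf top1            w = tt ∷ []
  subC-wf (cname A)       w = tt ∷ []
  subC-wf (cneg C)        w = w ∷ subC-wf C w
  subC-wf (cand C D)      w = w ∷ ++⁺ (subC-wf C (proj₁ w)) (subC-wf D (proj₂ w))
  subC-wf (cexists n i R) w = w ∷ subR-wf R w
  subC-wf (cnom o)        w = tt ∷ []

  subR-wf : ∀ {m n} (R : Role n) → WFR m R → All (WFE m) (subR R)
  subR-wf (topN _)   w = w ∷ []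
  subR-wf (rname P)  w = w ∷ []
  subR-wf (rsel i C) w = w ∷ subC-wf C (proj₂ w)
  subR-wf (rneg R)   w = w ∷ subR-wf R (proj₂ w)
  subR-wf (rand R S) w = w ∷ ++⁺ (subR-wf R (proj₁ (proj₂ w))) (subR-wf S (proj₂ (proj₂ w)))

subAx-wf : ∀ {m} (a : Axiom) → WFAx m a → All (WFE m) (subAx a)
subAx-wf (cinc C D)   (wC , wD) = ++⁺ (subC-wf C wC) (subC-wf D wD)
subAx-wf (rinc n R S) (wR , wS) = ++⁺ (subR-wf R wR) (subR-wf S wS)

topsOf-wf : ∀ {m} (e : Expr) → WFE m e → All (WFE m) (topsOf e)
topsOf-wf (ce C)            w = []
topsOf-wf (re n (topN _))   w = []
topsOf-wf (re n (rname P))  w = w ∷ []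
topsOf-wf (re n (rsel i C)) w = []
topsOf-wf (re n (rneg R))   w = []
topsOf-wf (re n (rand R S)) w = []

clos-wf : ∀ {m} (Sig : KB) → IsDLRKB m Sig → All (WFE m) (clos Sig)
clos-wf Sig w = tt ∷ ++⁺ base-wf (concatMap⁺ topsOf (All.map (topsOf-wf _) base-wf))
  where base-wf = concatMap⁺ subAx (All.map (subAx-wf _) w)

mutual
  length-subC≤sizeC : (C : Concept) → length (subC C) ≤ sizeC C
  length-subC≤sizeC top1            = ≤-refl
  length-subC≤sizeC (cname A)       = ≤-refl
  length-subC≤sizeC (cneg C)        = s≤s (length-subC≤sizeC C)
  length-subC≤sizeC (cand C D)      rewrite length-++ (subC C) {subC D} =
    s≤s (+-mono-≤ (length-subC≤sizeC C) (length-subC≤sizeC D))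
  length-subC≤sizeC (cexists n i R) = s≤s (length-subR≤sizeR R)
  length-subC≤sizeC (cnom o)        = ≤-refl

  length-subR≤sizeR : ∀ {n} (R : Role n) → length (subR R) ≤ sizeR R
  length-subR≤sizeR (topN _)   = ≤-refl
  length-subR≤sizeR (rname P)  = ≤-refl
  length-subR≤sizeR (rsel i C) = s≤s (length-subC≤sizeC C)
  length-subR≤sizeR (rneg R)   = s≤s (length-subR≤sizeR R)
  length-subR≤sizeR (rand R S) rewrite length-++ (subR R) {subR S} =
    s≤s (+-mono-≤ (length-subR≤sizeR R) (length-subR≤sizeR S))

length-subAx≤sizeAx : (a : Axiom) → length (subAx a) ≤ sizeAx a
length-subAx≤sizeAx (cinc C D) rewrite length-++ (subC C) {subC D} =
  m≤n⇒m≤1+n (+-mono-≤ (length-subC≤sizeC C) (length-subC≤sizeC D))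
length-subAx≤sizeAx (rinc n R S) rewrite length-++ (subR R) {subR S} =
  m≤n⇒m≤1+n (+-mono-≤ (length-subR≤sizeR R) (length-subR≤sizeR S))

length-concatMap≤ : (f : A → List B) (g : A → ℕ) {xs : List A} →
                    All (λ x → length (f x) ≤ g x) xs →
                    length (concatMap f xs) ≤ sum (map g xs)
length-concatMap≤ f g {xs} h rewrite length-concatMap f xs = sum-map-mono (length ∘ f) g h

length-concatMap≤* : (f : A → List B) {xs : List A} →
                     All (λ x → length (f x) ≤ b) xs →
                     length (concatMap f xs) ≤ length xs * b
length-concatMap≤* f {xs} h rewrite length-concatMap f xs = sum-map-≤ (length ∘ f) h

length-topsOf≤1 : (e : Expr) → length (topsOf e) ≤ 1
length-topsOf≤1 (ce C)            = z≤n
length-topsOf≤1 (re n (topN _))   = z≤n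
length-topsOf≤1 (re n (rname P))  = ≤-refl
length-topsOf≤1 (re n (rsel i C)) = z≤n
length-topsOf≤1 (re n (rneg R))   = z≤n
length-topsOf≤1 (re n (rand R S)) = z≤n

length-clos : (Sig : KB) → length (clos Sig) ≤ suc (sizeKB Sig + sizeKB Sig)
length-clos Sig = s≤s (begin
  length (base ++ concatMap topsOf base)          ≡⟨ length-++ base ⟩
  length base + length (concatMap topsOf base)    ≤⟨ +-monoʳ-≤ (length base) tops≤ ⟩
  length base + length base * 1                   ≡⟨ cong (length base +_) (*-identityʳ (length base)) ⟩
  length base + length base                       ≤⟨ +-mono-≤ base≤ base≤ ⟩
  sizeKB Sig + sizeKB Sig                         ∎)
  where
  open ≤-Reasoning
  base = concatMap subAx Sig
  base≤ : length base ≤ sizeKB Sig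
  base≤ = length-concatMap≤ subAx sizeAx (universal length-subAx≤sizeAx Sig)
  tops≤ : length (concatMap topsOf base) ≤ length base * 1
  tops≤ = length-concatMap≤* topsOf (universal length-topsOf≤1 base)

length-axRules≤sizeAx : (a : Axiom) → length (axRules a) ≤ sizeAx a
length-axRules≤sizeAx (cinc C D)   = s≤s z≤n
length-axRules≤sizeAx (rinc n R S) = s≤s z≤n

length-exprRules≤2 : (e : Expr) → length (exprRules e) ≤ 2
length-exprRules≤2 (ce top1)            = z≤n
length-exprRules≤2 (ce (cname A))       = s≤s z≤n
length-exprRules≤2 (ce (cneg E))        = s≤s z≤n
length-exprRules≤2 (ce (cand E F))      = s≤s z≤n
length-exprRules≤2 (ce (cexists n i R)) = s≤s z≤n
length-exprRules≤2 (ce (cnom o))        = s≤s z≤n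
length-exprRules≤2 (re n (topN .n))     = s≤s z≤n
length-exprRules≤2 (re n (rname P))     = ≤-refl
length-exprRules≤2 (re n (rsel i C))    = s≤s z≤n
length-exprRules≤2 (re n (rneg R))      = s≤s z≤n
length-exprRules≤2 (re n (rand R S))    = s≤s z≤n

length-Φ : (Sig : KB) → length (Φ Sig) ≤ 5 * suc (sizeKB Sig)
length-Φ Sig = begin
  2 + length (axs ++ exs)        ≡⟨ cong (2 +_) (length-++ axs) ⟩
  2 + (length axs + length exs)  ≤⟨ +-monoʳ-≤ 2 (+-mono-≤ axs≤ exs≤) ⟩
  2 + (s + suc (s + s) * 2)      ≡⟨ arith s ⟩
  4 + 5 * s                      ≤⟨ n≤1+n _ ⟩
  5 + 5 * s                      ≡⟨ *-suc 5 s ⟨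
  5 * suc s                      ∎
  where
  open ≤-Reasoning
  s = sizeKB Sig
  axs = concatMap axRules Sig
  exs = concatMap exprRules (clos Sig)
  axs≤ : length axs ≤ s
  axs≤ = length-concatMap≤ axRules sizeAx (universal length-axRules≤sizeAx Sig)
  exs≤ : length exs ≤ suc (s + s) * 2
  exs≤ = ≤-trans (length-concatMap≤* exprRules (universal length-exprRules≤2 (clos Sig)))
                 (*-monoˡ-≤ 2 (length-clos Sig))
  arith : ∀ s → 2 + (s + suc (s + s) * 2) ≡ 4 + 5 * s
  arith = solve-∀

length-Xs : ∀ n → length (Xs n) ≡ n
length-Xs n = trans (length-map var (upTo n)) (length-upTo n)

module RuleSize (m : ℕ) where

  litBound : ℕ
  litBound = 3 + m

  ruleBound : ℕ
  ruleBound = suc (3 * litBound)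

  -- Records rather than bare inequalities, so that the literal or rule
  -- is inferred from the expected type.
  record LitBounded (l : Literal) : Set where
    constructor mkLitBounded
    field sizeLit≤ : sizeLit l ≤ litBound

  record RuleBounded (r : Rule) : Set where
    constructor mkRuleBounded
    field sizeRule≤ : sizeRule r ≤ ruleBound

  pos-bounded : ∀ {p ts} → length ts ≤ suc m → LitBounded (pos (app p ts))
  pos-bounded ℓ≤ = mkLitBounded (s≤s (m≤n⇒m≤1+n ℓ≤))

  naf-bounded : ∀ {p ts} → length ts ≤ suc m → LitBounded (naf (app p ts))
  naf-bounded ℓ≤ = mkLitBounded (s≤s (s≤s ℓ≤))

  pos-unary-bounded : ∀ {p t} → LitBounded (pos (app p (t ∷ [])))
  pos-unary-bounded = pos-bounded (s≤s z≤n)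

  naf-unary-bounded : ∀ {p t} → LitBounded (naf (app p (t ∷ [])))
  naf-unary-bounded = naf-bounded (s≤s z≤n)

  length-Xs-wf : ∀ {n} (R : Role n) → WFR m R → length (Xs n) ≤ suc m
  length-Xs-wf {n} R w rewrite length-Xs n = m≤n⇒m≤1+n (WFR⇒arity≤ R w)

  -- For a concrete rule the implicit argument reduces to ⊤ and is inferred.
  rule-bounded : ∀ {r} → All LitBounded (head r) → All LitBounded (body r) →
                 {T (length (head r) + length (body r) ≤ᵇ 3)} → RuleBounded r
  rule-bounded {r} hs bs {≤3} = mkRuleBounded (s≤s (begin
    sum (map sizeLit (head r)) + sum (map sizeLit (body r))
      ≤⟨ +-mono-≤ (sum-map-≤ sizeLit (All.map LitBounded.sizeLit≤ hs))
                   (sum-map-≤ sizeLit (All.map LitBounded.sizeLit≤ bs)) ⟩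
    length (head r) * litBound + length (body r) * litBound
      ≡⟨ *-distribʳ-+ litBound (length (head r)) (length (body r)) ⟨
    (length (head r) + length (body r)) * litBound
      ≤⟨ *-monoˡ-≤ litBound (≤ᵇ⇒≤ (length (head r) + length (body r)) 3 ≤3) ⟩
    3 * litBound ∎))
    where open ≤-Reasoning

  exprRules-bounded : (e : Expr) → WFE m e → All RuleBounded (exprRules e)
  exprRules-bounded (ce top1)            w = []
  exprRules-bounded (ce (cname A))       w =
    rule-bounded (pos-unary-bounded ∷ naf-unary-bounded ∷ []) [] ∷ []
  exprRules-bounded (ce (cneg E))        w =
    rule-bounded (pos-unary-bounded ∷ []) (naf-unary-bounded ∷ []) ∷ []
  exprRules-bounded (ce (cand E F))      w =
    rule-bounded (pos-unary-bounded ∷ []) (pos-unary-bounded ∷ pos-unary-bounded ∷ []) ∷ []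
  exprRules-bounded (ce (cexists n i R)) w =
    rule-bounded (pos-unary-bounded ∷ []) (pos-bounded (length-Xs-wf R w) ∷ []) ∷ []
  exprRules-bounded (ce (cnom o))        w =
    rule-bounded (pos-unary-bounded ∷ []) [] ∷ []
  exprRules-bounded (re n (topN .n))     w =
    rule-bounded (pos-bounded ℓ≤ ∷ naf-bounded ℓ≤ ∷ []) [] ∷ []
    where ℓ≤ = length-Xs-wf (topN n) w
  exprRules-bounded (re n (rname P))     w =
    rule-bounded (pos-bounded ℓ≤ ∷ naf-bounded ℓ≤ ∷ []) [] ∷
    rule-bounded [] (pos-bounded ℓ≤ ∷ naf-bounded ℓ≤ ∷ []) ∷ []
    where ℓ≤ = length-Xs-wf (rname {n} P) w
  exprRules-bounded (re n (rsel i C))    w =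
    rule-bounded (pos-bounded ℓ≤ ∷ []) (pos-bounded ℓ≤ ∷ pos-unary-bounded ∷ []) ∷ []
    where ℓ≤ = length-Xs-wf (rsel i C) w
  exprRules-bounded (re n (rneg R))      w =
    rule-bounded (pos-bounded ℓ≤ ∷ []) (pos-bounded ℓ≤ ∷ naf-bounded ℓ≤ ∷ []) ∷ []
    where ℓ≤ = length-Xs-wf (rneg R) w
  exprRules-bounded (re n (rand R S))    w =
    rule-bounded (pos-bounded ℓ≤ ∷ []) (pos-bounded ℓ≤ ∷ pos-bounded ℓ≤ ∷ []) ∷ []
    where ℓ≤ = length-Xs-wf (rand R S) w

  axRules-bounded : (a : Axiom) → WFAx m a → All RuleBounded (axRules a)
  axRules-bounded (cinc C D)   w =
    rule-bounded [] (pos-unary-bounded ∷ naf-unary-bounded ∷ []) ∷ []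
  axRules-bounded (rinc n R S) (wR , _) =
    rule-bounded [] (pos-bounded ℓ≤ ∷ naf-bounded ℓ≤ ∷ []) ∷ []
    where ℓ≤ = length-Xs-wf R wR

  Φ-bounded : (Sig : KB) → IsDLRKB m Sig → All RuleBounded (Φ Sig)
  Φ-bounded Sig w =
    rule-bounded (pos-unary-bounded ∷ naf-unary-bounded ∷ []) [] ∷
    rule-bounded [] (naf-unary-bounded ∷ []) ∷
    ++⁺ (concatMap⁺ axRules (All.map (axRules-bounded _) w))
        (concatMap⁺ exprRules (All.map (exprRules-bounded _) (clos-wf Sig w)))

  sizeProg-Φ : (Sig : KB) → IsDLRKB m Sig → sizeProg (Φ Sig) ≤ length (Φ Sig) * ruleBound
  sizeProg-Φ Sig w = sum-map-≤ sizeRule (All.map RuleBounded.sizeRule≤ (Φ-bounded Sig w))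

  sizeProg-Φ-++ : (Sig : KB) (P : Program) → IsDLRKB m Sig →
                  sizeProg (Φ Sig ++ P) ≤ 5 * ruleBound * (sizeKB Sig + sizeProg P) ^ 1 + 5 * ruleBound
  sizeProg-Φ-++ Sig P w = begin
    sizeProg (Φ Sig ++ P)                 ≡⟨ sizeProg-++ (Φ Sig) P ⟩
    sizeProg (Φ Sig) + p                  ≤⟨ +-monoˡ-≤ p (sizeProg-Φ Sig w) ⟩
    length (Φ Sig) * ruleBound + p        ≤⟨ +-mono-≤ (*-monoˡ-≤ ruleBound (length-Φ Sig))
                                                      (m≤n*m p (5 * ruleBound)) ⟩
    5 * suc s * ruleBound + 5 * ruleBound * p   ≡⟨ linear ruleBound s p ⟩
    5 * ruleBound * ((s + p) * 1) + 5 * ruleBound  ∎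
    where
    open ≤-Reasoning
    s = sizeKB Sig
    p = sizeProg P
    linear : ∀ R s p → 5 * suc s * R + 5 * R * p ≡ 5 * R * ((s + p) * 1) + 5 * R
    linear = solve-∀

theorem4p2 : (nmax : ℕ) →
    Σ[ c ∈ ℕ ] Σ[ k ∈ ℕ ]
      ((Sig : KB) (P : Program) → IsDLRKB nmax Sig → GuardedProgram P →
        GuardedProgram (Φ Sig ++ P) ×
        sizeProg (Φ Sig ++ P) ≤ c * (sizeKB Sig + sizeProg P) ^ k + c)
theorem4p2 nmax =
  5 * ruleBound , 1 , λ Sig P wf guarded → ++⁺ (Φ-guarded Sig) guarded , sizeProg-Φ-++ Sig P wf
  where open RuleSize nmax
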